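{- For all ${\sf FIL}$-formulas $A,B,C$: ${\sf FIL}\vdash A\rhd B\to\neg(A\rhd\neg C)\rhd(B\wedge\Box C)$ (the principle $\mathsf R$).
   Context: The logic ${\sf FIL}$: the language has propositional variables, interpretation variables $k_0,k_1,\dots$, one interpretation constant ${\sf id}$, $\top,\bot$, Boolean connectives and modalities $\Box^{\mathfrak a}A$, $A\rhd^{\mathfrak a}B$ where $\mathfrak a$ is a finite sequence of interpretation terms without repetition; unlabelled $\Box,\rhd$ stand for label ${\sf id}$ / the empty sequence; $\Diamond^{\mathfrak a}:=\neg\Box^{\mathfrak a}\neg$; $\mathfrak a,k$ is $\mathfrak a$ extended by $k$. Sequents $\Gamma\vdash C$ with $\Gamma$ a multiset, with $\Gamma,\Delta\vdash C$ iff $\Delta\vdash\bigwedge\Gamma\to C$. Axioms/rules (for all labels $\mathfrak a,\mathfrak b$, terms $k$): all tautologies; modus ponens; $\Box^{\mathfrak a}(A\to B)\to(\Box^{\mathfrak a}A\to\Box^{\mathfrak a}B)$; $\Box^{\mathfrak b}A\to\Box^{\mathfrak a}\Box^{\mathfrak b}A$; $\Box^{\mathfrak a}(\Box^{\mathfrak a}A\to A)\to\Box^{\mathfrak a}A$; $\Box^{\mathfrak a}(A\to B)\to A\rhd^{\mathfrak a}B$; $(A\rhd B)\wedge(B\rhd^{\mathfrak a}C)\to A\rhd^{\mathfrak a}C$; $(A\rhd^{\mathfrak a}B)\wedge\Box^{\mathfrak a}(B\to C)\to A\rhd^{\mathfrak a}C$; $(A\rhd^{\mathfrak a}C)\wedge(B\rhd^{\mathfrak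 a}C)\to A\vee B\rhd^{\mathfrak a}C$; $A\rhd^{\mathfrak a}B\to(\Diamond A\to\Diamond^{\mathfrak a}B)$; $A\rhd^{\mathfrak a}\Diamond^{\mathfrak b}B\to A\rhd^{\mathfrak b}B$; $\Box^{\mathfrak a,k}A\to\Box^{\mathfrak a}A$; $A\rhd^{\mathfrak a}B\to A\rhd^{\mathfrak a,k}B$; necessitation $\vdash A\Rightarrow\vdash\Box^{\mathfrak a}A$; rule $\mathsf P^{\mathfrak a,\mathfrak b,k}$: from $\Gamma,\Delta,\Box^{\mathfrak b}(A\rhd^{\mathfrak a,k}B)\vdash C$ infer $\Gamma,A\rhd^{\mathfrak a}B\vdash C$, provided $k$ is an interpretation variable not occurring in $\mathfrak a,\Gamma,A,B,C$ and $\Delta$ consists of formulas of the forms $E\rhd^{\mathfrak a,k}F\to E\rhd^{\mathfrak a}F$ and $\Box^{\mathfrak a}E\to\Box^{\mathfrak a,k}E$. -}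

module Defs where

open import Data.Nat using (ℕ; _≡ᵇ_)
open import Data.Bool using (Bool; true; false; not; _∧_; _∨_; T)
open import Data.List using (List; []; _∷_; _++_; [_])
open import Relation.Binary.PropositionalEquality using (_≡_)

data ITerm : Set where
  ivar : ℕ → ITerm
  idc  : ITerm

_==ᵗ_ : ITerm → ITerm → Bool
ivar m ==ᵗ ivar n = m ≡ᵇ n
ivar _ ==ᵗ idc    = false
idc    ==ᵗ ivar _ = false
idc    ==ᵗ idc    = true

elemᵗ : ITerm → List ITerm → Bool
elemᵗ t []       = false
elemᵗ t (u ∷ us) = (t ==ᵗ u) ∨ elemᵗ t us

noRep : List ITerm → Bool
noRep []       = true
noRep (t ∷ ts) = not (elemᵗ t ts) ∧ noRep ts

-- Labels: finite sequences of interpretation terms without repetition.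
-- (The witness lives in T of a Bool, hence is proof-irrelevant: two labels
-- with the same underlying sequence are definitionally the same.)

record Label : Set where
  constructor mkLabel
  field
    seq   : List ITerm
    nodup : T (noRep seq)
open Label public

ε : Label
ε = mkLabel [] _

idL : Label
idL = mkLabel [ idc ] _

ext : (a : Label) (k : ITerm) → T (noRep (seq a ++ [ k ])) → Label
ext a k p = mkLabel (seq a ++ [ k ]) p

infixr 6 _⇒_
infixr 7 _∨ᶠ_
infixr 8 _∧ᶠ_

data Fm : Set where
  pv    : ℕ → Fm
  ⊤ᶠ ⊥ᶠ : Fm
  ¬ᶠ_   : Fm → Fm
  _∧ᶠ_ _∨ᶠ_ _⇒_ : Fm → Fm → Fm
  □[_]_ : Label → Fm → Fm
  _▷[_]_ : Fm → Label → Fm → Fm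

◇[_]_ : Label → Fm → Fm
◇[ a ] A = ¬ᶠ (□[ a ] (¬ᶠ A))

□_ : Fm → Fm
□ A = □[ idL ] A

◇_ : Fm → Fm
◇ A = ◇[ idL ] A

_▷_ : Fm → Fm → Fm
A ▷ B = A ▷[ ε ] B

-- Tautologies: true under every Boolean valuation of the "atoms"
-- (propositional variables and modal formulas).

eval : (Fm → Bool) → Fm → Bool
eval v (pv p)       = v (pv p)
eval v ⊤ᶠ           = true
eval v ⊥ᶠ           = false
eval v (¬ᶠ A)       = not (eval v A)
eval v (A ∧ᶠ B)     = eval v A ∧ eval v B
eval v (A ∨ᶠ B)     = eval v A ∨ eval v B
eval v (A ⇒ B)      = not (eval v A) ∨ eval v B
eval v (□[ a ] A)   = v (□[ a ] A)
eval v (A ▷[ a ] B) = v (A ▷[ a ] B)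

Tautology : Fm → Set
Tautology A = (v : Fm → Bool) → eval v A ≡ true

occL : ℕ → Label → Bool
occL n a = elemᵗ (ivar n) (seq a)

occ : ℕ → Fm → Bool
occ n (pv _)       = false
occ n ⊤ᶠ           = false
occ n ⊥ᶠ           = false
occ n (¬ᶠ A)       = occ n A
occ n (A ∧ᶠ B)     = occ n A ∨ occ n B
occ n (A ∨ᶠ B)     = occ n A ∨ occ n B
occ n (A ⇒ B)      = occ n A ∨ occ n B
occ n (□[ a ] A)   = occL n a ∨ occ n A
occ n (A ▷[ a ] B) = occ n A ∨ occL n a ∨ occ n B

occs : ℕ → List Fm → Bool
occs n []       = false
occs n (A ∷ Γ)  = occ n A ∨ occs n Γ

-- Sequents: Γ ⊢ C is ⊢ ⋀Γ → C (Γ a list; order is irrelevant up to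
-- tautologies)

⋀ : List Fm → Fm
⋀ []      = ⊤ᶠ
⋀ (A ∷ Γ) = A ∧ᶠ ⋀ Γ

-- Formulas allowed in Δ for the rule P^{𝔞,𝔟,k}, where ak is 𝔞,k
data ΔForm (a ak : Label) : Fm → Set where
  ▷-down : (E F : Fm) → ΔForm a ak ((E ▷[ ak ] F) ⇒ (E ▷[ a ] F))
  □-up   : (E : Fm)   → ΔForm a ak ((□[ a ] E) ⇒ (□[ ak ] E))

data AllΔ (a ak : Label) : List Fm → Set where
  []  : AllΔ a ak []
  _∷_ : ∀ {D Δ} → ΔForm a ak D → AllΔ a ak Δ → AllΔ a ak (D ∷ Δ)

infix 4 FIL⊢_

data FIL⊢_ : Fm → Set where
  taut : ∀ {A} → Tautology A → FIL⊢ A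
  mp   : ∀ {A B} → FIL⊢ (A ⇒ B) → FIL⊢ A → FIL⊢ B
  K    : ∀ a A B → FIL⊢ (□[ a ] (A ⇒ B) ⇒ (□[ a ] A ⇒ □[ a ] B))
  Four : ∀ a b A → FIL⊢ (□[ b ] A ⇒ □[ a ] (□[ b ] A))
  Löb  : ∀ a A → FIL⊢ (□[ a ] (□[ a ] A ⇒ A) ⇒ □[ a ] A)
  J1   : ∀ a A B → FIL⊢ (□[ a ] (A ⇒ B) ⇒ A ▷[ a ] B)
  J2   : ∀ a A B C → FIL⊢ ((A ▷ B) ∧ᶠ (B ▷[ a ] C) ⇒ A ▷[ a ] C)
  J2′  : ∀ a A B C → FIL⊢ ((A ▷[ a ] B) ∧ᶠ □[ a ] (B ⇒ C) ⇒ A ▷[ a ] C)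
  J3   : ∀ a A B C → FIL⊢ ((A ▷[ a ] C) ∧ᶠ (B ▷[ a ] C) ⇒ (A ∨ᶠ B) ▷[ a ] C)
  J4   : ∀ a A B → FIL⊢ (A ▷[ a ] B ⇒ (◇ A ⇒ ◇[ a ] B))
  J5   : ∀ a b A B → FIL⊢ (A ▷[ a ] (◇[ b ] B) ⇒ A ▷[ b ] B)
  □-mono : ∀ a k (p : T (noRep (seq a ++ [ k ]))) A →
           FIL⊢ (□[ ext a k p ] A ⇒ □[ a ] A)
  ▷-mono : ∀ a k (p : T (noRep (seq a ++ [ k ]))) A B →
           FIL⊢ (A ▷[ a ] B ⇒ A ▷[ ext a k p ] B)
  nec  : ∀ a {A} → FIL⊢ A → FIL⊢ □[ a ] A
  P    : ∀ a b (n : ℕ) (p : T (noRep (seq a ++ [ ivar n ])))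
           (Γ Δ : List Fm) (A B C : Fm) →
         T (not (occL n a)) → T (not (occs n Γ)) →
         T (not (occ n A)) → T (not (occ n B)) → T (not (occ n C)) →
         AllΔ a (ext a (ivar n) p) Δ →
         FIL⊢ (⋀ (Γ ++ Δ ++ [ □[ b ] (A ▷[ ext a (ivar n) p ] B) ]) ⇒ C) →
         FIL⊢ (⋀ (Γ ++ [ A ▷[ a ] B ]) ⇒ C)

{-# OPTIONS --safe #-}
-- Apply rule P to A ▷ B with a fresh k and Δ = {X ▷ᵏ Y → X ▷ Y}, where X = ¬(A ▷ ¬C) and
-- Y = B ∧ □C; it remains to derive X ▷ᵏ Y from □ᵇ(A ▷ᵏ B). Since ¬□C → ◇ᵃ¬C for every label a
-- (J4 applied to ¬C ▷ᵃ ¬C), the assumption □ᵏ¬Y yields □ᵏ(B → ◇ᵋ¬C); together with A ▷ᵏ B this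
-- gives A ▷ᵏ ◇ᵋ¬C by J2′ and then A ▷ ¬C by J5, contradicting X. Hence □ᵇ(X → ◇ᵏY), which J1
-- and J5 turn into X ▷ᵏ Y.
module Submission where

open import Defs
open import Data.Bool using (Bool; true; false; not; _∧_; _∨_; T)
open import Data.Bool.Properties using (T-≡; T-∧; T-∨)
open import Data.Fin using (Fin; zero; suc)
open import Data.List using (List; []; _∷_; [_]; _++_; foldr)
open import Data.List.Relation.Unary.All using (All; []; _∷_)
open import Data.Nat using (ℕ; zero; suc; _⊔_; _<_; _≤_; s≤s)
open import Data.Nat.Properties
  using (≡ᵇ⇒≡; ≤-reflexive; <⇒≱; m<n⇒m<n⊔o; m<n⇒m<o⊔n; m⊔n≤o⇒m≤o; m⊔n≤o⇒n≤o; ≤-refl)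
open import Data.Product using (proj₁; proj₂)
open import Data.Sum using ([_,_])
open import Data.Unit using (tt)
open import Data.Vec using (Vec; []; _∷_; lookup; map)
open import Data.Vec.Properties using (lookup-map)
open import Function using (_∘_; Equivalence)
open import Relation.Binary.PropositionalEquality using (_≡_; refl; sym; trans; cong; cong₂)
open import Relation.Nullary using (¬_)

open Equivalence using (to)

private variable
  n : ℕ

infixr 6 _⇒ˢ_
infixr 7 _∨ˢ_
infixr 8 _∧ˢ_

data Schema (n : ℕ) : Set where
  var           : Fin n → Schema n
  ⊤ˢ ⊥ˢ         : Schema n
  ¬ˢ_           : Schema n → Schema n
  _∧ˢ_ _∨ˢ_ _⇒ˢ_ : Schema n → Schema n → Schema n

p₀ : Schema (suc n)
p₀ = var zero

p₁ : Schema (suc (suc n))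
p₁ = var (suc zero)

p₂ : Schema (suc (suc (suc n)))
p₂ = var (suc (suc zero))

p₃ : Schema (suc (suc (suc (suc n))))
p₃ = var (suc (suc (suc zero)))

p₄ : Schema (suc (suc (suc (suc (suc n)))))
p₄ = var (suc (suc (suc (suc zero))))

_⟨_⟩ : Schema n → Vec Fm n → Fm
var i    ⟨ σ ⟩ = lookup σ i
⊤ˢ       ⟨ σ ⟩ = ⊤ᶠ
⊥ˢ       ⟨ σ ⟩ = ⊥ᶠ
(¬ˢ φ)   ⟨ σ ⟩ = ¬ᶠ (φ ⟨ σ ⟩)
(φ ∧ˢ ψ) ⟨ σ ⟩ = φ ⟨ σ ⟩ ∧ᶠ ψ ⟨ σ ⟩
(φ ∨ˢ ψ) ⟨ σ ⟩ = φ ⟨ σ ⟩ ∨ᶠ ψ ⟨ σ ⟩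
(φ ⇒ˢ ψ) ⟨ σ ⟩ = φ ⟨ σ ⟩ ⇒ ψ ⟨ σ ⟩

⟦_⟧ : Schema n → Vec Bool n → Bool
⟦ var i   ⟧ ρ = lookup ρ i
⟦ ⊤ˢ      ⟧ ρ = true
⟦ ⊥ˢ      ⟧ ρ = false
⟦ ¬ˢ φ    ⟧ ρ = not (⟦ φ ⟧ ρ)
⟦ φ ∧ˢ ψ ⟧ ρ = ⟦ φ ⟧ ρ ∧ ⟦ ψ ⟧ ρ
⟦ φ ∨ˢ ψ ⟧ ρ = ⟦ φ ⟧ ρ ∨ ⟦ ψ ⟧ ρ
⟦ φ ⇒ˢ ψ ⟧ ρ = not (⟦ φ ⟧ ρ) ∨ ⟦ ψ ⟧ ρ

eval-⟨⟩ : ∀ v (φ : Schema n) σ → eval v (φ ⟨ σ ⟩) ≡ ⟦ φ ⟧ (map (eval v) σ)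
eval-⟨⟩ v (var i)  σ = sym (lookup-map i (eval v) σ)
eval-⟨⟩ v ⊤ˢ       σ = refl
eval-⟨⟩ v ⊥ˢ       σ = refl
eval-⟨⟩ v (¬ˢ φ)   σ = cong not (eval-⟨⟩ v φ σ)
eval-⟨⟩ v (φ ∧ˢ ψ) σ = cong₂ _∧_ (eval-⟨⟩ v φ σ) (eval-⟨⟩ v ψ σ)
eval-⟨⟩ v (φ ∨ˢ ψ) σ = cong₂ _∨_ (eval-⟨⟩ v φ σ) (eval-⟨⟩ v ψ σ)
eval-⟨⟩ v (φ ⇒ˢ ψ) σ = cong₂ (λ x y → not x ∨ y) (eval-⟨⟩ v φ σ) (eval-⟨⟩ v ψ σ)

everywhere : ∀ n → (Vec Bool n → Bool) → Bool
everywhere zero    f = f []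
everywhere (suc n) f = everywhere n (f ∘ (true ∷_)) ∧ everywhere n (f ∘ (false ∷_))

everywhere-sound : ∀ n f → T (everywhere n f) → (ρ : Vec Bool n) → T (f ρ)
everywhere-sound zero    f valid []          = valid
everywhere-sound (suc n) f valid (true ∷ ρ)  = everywhere-sound n _ (proj₁ (to T-∧ valid)) ρ
everywhere-sound (suc n) f valid (false ∷ ρ) = everywhere-sound n _ (proj₂ (to T-∧ valid)) ρ

Valid : Schema n → Set
Valid {n} φ = T (everywhere n ⟦ φ ⟧)

-- The validity proof is found by evaluation whenever φ is a closed valid schema.
taut-schema : (φ : Schema n) {_ : Valid φ} (σ : Vec Fm n) → FIL⊢ (φ ⟨ σ ⟩)
taut-schema φ {valid} σ = taut λ v →
  trans (eval-⟨⟩ v φ σ) (to T-≡ (everywhere-sound _ ⟦ φ ⟧ valid (map (eval v) σ)))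

ivarBoundᴸ : List ITerm → ℕ
ivarBoundᴸ []            = 0
ivarBoundᴸ (ivar m ∷ ts) = suc m ⊔ ivarBoundᴸ ts
ivarBoundᴸ (idc ∷ ts)    = ivarBoundᴸ ts

ivarBound : Fm → ℕ
ivarBound (pv _)       = 0
ivarBound ⊤ᶠ           = 0
ivarBound ⊥ᶠ           = 0
ivarBound (¬ᶠ A)       = ivarBound A
ivarBound (A ∧ᶠ B)     = ivarBound A ⊔ ivarBound B
ivarBound (A ∨ᶠ B)     = ivarBound A ⊔ ivarBound B
ivarBound (A ⇒ B)      = ivarBound A ⊔ ivarBound B
ivarBound (□[ a ] A)   = ivarBoundᴸ (seq a) ⊔ ivarBound A
ivarBound (A ▷[ a ] B) = ivarBound A ⊔ (ivarBoundᴸ (seq a) ⊔ ivarBound B)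

∨⇒<⊔ : ∀ {x y i j} → (T x → n < i) → (T y → n < j) → T (x ∨ y) → n < i ⊔ j
∨⇒<⊔ x⇒<i y⇒<j x∨y = [ m<n⇒m<n⊔o _ ∘ x⇒<i , m<n⇒m<o⊔n _ ∘ y⇒<j ] (to T-∨ x∨y)

elemᵗ⇒<ivarBoundᴸ : ∀ n ts → T (elemᵗ (ivar n) ts) → n < ivarBoundᴸ ts
elemᵗ⇒<ivarBoundᴸ n (ivar m ∷ ts) =
  ∨⇒<⊔ (s≤s ∘ ≤-reflexive ∘ ≡ᵇ⇒≡ n m) (elemᵗ⇒<ivarBoundᴸ n ts)
elemᵗ⇒<ivarBoundᴸ n (idc ∷ ts) = elemᵗ⇒<ivarBoundᴸ n ts

occ⇒<ivarBound : ∀ n F → T (occ n F) → n < ivarBound F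
occ⇒<ivarBound n (¬ᶠ A)       = occ⇒<ivarBound n A
occ⇒<ivarBound n (A ∧ᶠ B)     = ∨⇒<⊔ (occ⇒<ivarBound n A) (occ⇒<ivarBound n B)
occ⇒<ivarBound n (A ∨ᶠ B)     = ∨⇒<⊔ (occ⇒<ivarBound n A) (occ⇒<ivarBound n B)
occ⇒<ivarBound n (A ⇒ B)      = ∨⇒<⊔ (occ⇒<ivarBound n A) (occ⇒<ivarBound n B)
occ⇒<ivarBound n (□[ a ] A)   = ∨⇒<⊔ (elemᵗ⇒<ivarBoundᴸ n (seq a)) (occ⇒<ivarBound n A)
occ⇒<ivarBound n (A ▷[ a ] B) =
  ∨⇒<⊔ (occ⇒<ivarBound n A) (∨⇒<⊔ (elemᵗ⇒<ivarBoundᴸ n (seq a)) (occ⇒<ivarBound n B))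

¬T⇒T-not : ∀ {b} → ¬ T b → T (not b)
¬T⇒T-not {false} _  = tt
¬T⇒T-not {true}  ¬b = ¬b tt

fresh : List Fm → ℕ
fresh = foldr (λ F m → ivarBound F ⊔ m) 0

fresh≤⇒∉ : ∀ Γ → fresh Γ ≤ n → All (λ F → T (not (occ n F))) Γ
fresh≤⇒∉ []      _  = []
fresh≤⇒∉ (F ∷ Γ) Γ≤n =
  ¬T⇒T-not (λ n∈F → <⇒≱ (occ⇒<ivarBound _ F n∈F) (m⊔n≤o⇒m≤o _ _ Γ≤n))
  ∷ fresh≤⇒∉ Γ (m⊔n≤o⇒n≤o _ _ Γ≤n)

fresh-∉ : ∀ Γ → All (λ F → T (not (occ (fresh Γ) F))) Γ
fresh-∉ Γ = fresh≤⇒∉ Γ ≤-refl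

⇒-trans : ∀ {A B C} → FIL⊢ (A ⇒ B) → FIL⊢ (B ⇒ C) → FIL⊢ (A ⇒ C)
⇒-trans {A} {B} {C} A⇒B B⇒C =
  mp (mp (taut-schema ((p₀ ⇒ˢ p₁) ⇒ˢ (p₁ ⇒ˢ p₂) ⇒ˢ p₀ ⇒ˢ p₂) (A ∷ B ∷ C ∷ [])) A⇒B) B⇒C

□-map : ∀ a {A B} → FIL⊢ (A ⇒ B) → FIL⊢ (□[ a ] A ⇒ □[ a ] B)
□-map a {A} {B} A⇒B = mp (K a A B) (nec a A⇒B)

▷-refl : ∀ a A → FIL⊢ (A ▷[ a ] A)
▷-refl a A = mp (J1 a A A) (nec a (taut-schema (p₀ ⇒ˢ p₀) (A ∷ [])))

◇⇒◇[_] : ∀ a A → FIL⊢ (◇ A ⇒ ◇[ a ] A)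
◇⇒◇[ a ] A = mp (J4 a A A) (▷-refl a A)

¬□⇒◇[_]¬ : ∀ a C → FIL⊢ (¬ᶠ (□ C) ⇒ ◇[ a ] (¬ᶠ C))
¬□⇒◇[ a ]¬ C =
  mp (mp (taut-schema ((¬ˢ p₀ ⇒ˢ p₁) ⇒ˢ (p₀ ⇒ˢ p₂) ⇒ˢ ¬ˢ p₂ ⇒ˢ p₁)
                      (□ (¬ᶠ (¬ᶠ C)) ∷ ◇[ a ] (¬ᶠ C) ∷ □ C ∷ []))
         (◇⇒◇[ a ] (¬ᶠ C)))
     (□-map idL (taut-schema (¬ˢ ¬ˢ p₀ ⇒ˢ p₀) (C ∷ [])))

□◇⇒▷ : ∀ b c X Y → FIL⊢ (□[ b ] (X ⇒ ◇[ c ] Y) ⇒ X ▷[ c ] Y)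
□◇⇒▷ b c X Y = ⇒-trans (J1 b X (◇[ c ] Y)) (J5 b c X Y)

▷⇒▷-by-P : ∀ a b n (p : T (noRep (seq a ++ [ ivar n ]))) {A B X Y} →
  T (not (occL n a)) → T (not (occ n A)) → T (not (occ n B)) → T (not (occ n (X ▷[ a ] Y))) →
  FIL⊢ (□[ b ] (A ▷[ ext a (ivar n) p ] B) ⇒ X ▷[ ext a (ivar n) p ] Y) →
  FIL⊢ ((A ▷[ a ] B) ⇒ X ▷[ a ] Y)
▷⇒▷-by-P a b n p {A} {B} {X} {Y} n∉a n∉A n∉B n∉XY h =
  mp (taut-schema ((p₀ ∧ˢ ⊤ˢ ⇒ˢ p₁) ⇒ˢ p₀ ⇒ˢ p₁) (A ▷[ a ] B ∷ X ▷[ a ] Y ∷ []))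
     (P a b n p [] [ X ▷[ a,k ] Y ⇒ X ▷[ a ] Y ] A B (X ▷[ a ] Y)
        n∉a tt n∉A n∉B n∉XY (▷-down X Y ∷ []) premise)
  where
  a,k = ext a (ivar n) p
  premise : FIL⊢ ((X ▷[ a,k ] Y ⇒ X ▷[ a ] Y) ∧ᶠ □[ b ] (A ▷[ a,k ] B) ∧ᶠ ⊤ᶠ ⇒ X ▷[ a ] Y)
  premise = mp (taut-schema ((p₀ ⇒ˢ p₁) ⇒ˢ (p₁ ⇒ˢ p₂) ∧ˢ p₀ ∧ˢ ⊤ˢ ⇒ˢ p₂)
                            (□[ b ] (A ▷[ a,k ] B) ∷ X ▷[ a,k ] Y ∷ X ▷[ a ] Y ∷ []))
               h

▷⇒¬▷¬⇒◇∧□ : ∀ a c A B C → FIL⊢ ((A ▷[ c ] B) ⇒ ¬ᶠ (A ▷[ a ] (¬ᶠ C)) ⇒ ◇[ c ] (B ∧ᶠ □ C))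
▷⇒¬▷¬⇒◇∧□ a c A B C =
  mp (mp (mp (taut-schema contrapose-chain
                          (A ▷[ c ] B ∷ □[ c ] (¬ᶠ (B ∧ᶠ □ C)) ∷ □[ c ] (B ⇒ ◇¬C)
                             ∷ A ▷[ c ] ◇¬C ∷ A ▷[ a ] (¬ᶠ C) ∷ []))
             (□-map c ¬[B∧□C]⇒B⇒◇¬C))
         (J2′ c A B ◇¬C))
     (J5 c a A (¬ᶠ C))
  where
  ◇¬C = ◇[ a ] (¬ᶠ C)

  ¬[B∧□C]⇒B⇒◇¬C : FIL⊢ (¬ᶠ (B ∧ᶠ □ C) ⇒ B ⇒ ◇¬C)
  ¬[B∧□C]⇒B⇒◇¬C =
    mp (taut-schema ((¬ˢ p₀ ⇒ˢ p₁) ⇒ˢ ¬ˢ (p₂ ∧ˢ p₀) ⇒ˢ p₂ ⇒ˢ p₁) (□ C ∷ ◇¬C ∷ B ∷ []))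
       (¬□⇒◇[ a ]¬ C)

  contrapose-chain : Schema 5
  contrapose-chain = (p₁ ⇒ˢ p₂) ⇒ˢ (p₀ ∧ˢ p₂ ⇒ˢ p₃) ⇒ˢ (p₃ ⇒ˢ p₄) ⇒ˢ p₀ ⇒ˢ ¬ˢ p₄ ⇒ˢ ¬ˢ p₁

□▷⇒¬▷¬▷∧□ : ∀ a b c A B C →
  FIL⊢ (□[ b ] (A ▷[ c ] B) ⇒ (¬ᶠ (A ▷[ a ] (¬ᶠ C))) ▷[ c ] (B ∧ᶠ □ C))
□▷⇒¬▷¬▷∧□ a b c A B C = ⇒-trans (□-map b (▷⇒¬▷¬⇒◇∧□ a c A B C)) (□◇⇒▷ b c _ _)

mainTheorem6 : (A B C : Fm) → FIL⊢ ((A ▷ B) ⇒ ((¬ᶠ (A ▷ (¬ᶠ C))) ▷ (B ∧ᶠ □ C)))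
mainTheorem6 A B C with fresh-∉ (A ∷ B ∷ (¬ᶠ (A ▷ (¬ᶠ C))) ▷ (B ∧ᶠ □ C) ∷ [])
... | n∉A ∷ n∉B ∷ n∉R ∷ [] = ▷⇒▷-by-P ε ε _ tt tt n∉A n∉B n∉R (□▷⇒¬▷¬▷∧□ ε ε _ A B C)
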